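{- Let $D\in\mathbb{Z}$ and let $h_1,\dots,h_k$ be distinct integers, and put $P(x)=\prod_{j=1}^k((x+h_j)^2+D)$. Suppose there is $v\in\{ -1,+1\}$ such that $\lambda(P(n))=v$ for all sufficiently large $n$. Then the function $n\mapsto\lambda(n^2+D)$ is eventually periodic.
   Context: $\lambda$ is the Liouville function, $\lambda(n)=(-1)^{\Omega(n)}$ for $n\ge1$ ($\Omega$ counting prime factors with multiplicity), extended to $\mathbb{Z}$ as an even function with $\lambda(0)=1$. -}

module Defs where

open import Data.Nat as ℕ using (ℕ; zero; suc; _/_)
open import Data.Nat.Divisibility using (_∣?_)
open import Data.Fin using (Fin)
open import Data.Integer using (ℤ; +_; -_; _*_; ∣_∣)
open import Relation.Nullary using (yes; no)

-- Ω by trial division with fuel.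
-- Ωgo fuel n e : number of prime factors (with multiplicity) of n, given that
-- n has no divisor in [2, e+1]; the current trial divisor is d = 2 + e.
Ωgo : ℕ → ℕ → ℕ → ℕ
Ωgo zero    _             _ = 0
Ωgo (suc f) zero          _ = 0
Ωgo (suc f) (suc zero)    _ = 0
Ωgo (suc f) n@(suc (suc _)) e with (suc (suc e)) ∣? n
... | yes _ = suc (Ωgo f (n / suc (suc e)) e)
... | no  _ = Ωgo f n (suc e)

-- Ω(n): number of prime factors of n counted with multiplicity (Ω(0) = Ω(1) = 0;
-- the fuel 2n is more than enough for trial division to terminate).
Ω : ℕ → ℕ
Ω n = Ωgo (2 ℕ.* n) n 0

neg1^ : ℕ → ℤ
neg1^ zero    = + 1
neg1^ (suc m) = - neg1^ m

-- Liouville function on ℤ: λ(n) = (-1)^Ω(|n|) for n ≠ 0, even, λ(0) = 1.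
liouville : ℤ → ℤ
liouville z with ∣ z ∣
... | zero = + 1
... | suc m = neg1^ (Ω (suc m))

prodFin : (k : ℕ) → (Fin k → ℤ) → ℤ
prodFin zero    f = + 1
prodFin (suc k) f = f Fin.zero * prodFin k (λ j → f (Fin.suc j))
  where import Data.Fin as Fin

module Submission where

-- Write f m = λ(m² + D) and translate the h j to distinct offsets o j ≥ 0 with largest
-- offset s. For large m the factors (m + o j)² + D are nonzero, so complete multiplicativity
-- of λ turns the hypothesis into ∏ⱼ f (m + o j) = v. As f takes the values ±1 only, f (m + s)
-- is then determined by f m, …, f (m + s − 1), and a recurrence of finite order over a finite
-- alphabet is eventually periodic.

open import Defs
open import Data.Nat as ℕ
  using (ℕ; zero; suc; _≤_; _<_; _+_; _/_; _^_; _⊔_; s≤s; z≤n; NonZero)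
open import Data.Nat.Properties
open import Data.Nat.Induction using (<-rec)
open import Algebra.Properties.CommutativeSemigroup +-commutativeSemigroup using (x∙yz≈xz∙y; xy∙z≈xz∙y)
open import Data.Nat.Divisibility using (_∣?_; ∣⇒≤; m/n∣m)
open import Data.Nat.DivMod using (m*[n/m]≡n; m≥n⇒m/n>0)
open import Data.Nat.ListAction.Properties using (product-++)
open import Data.Nat.Primality using (_Rough_; 2-rough; rough⇒≤; ∤⇒rough-suc; rough∧∣⇒rough; rough∧∣⇒prime)
open import Data.Nat.Primality.Factorisation
  using (PrimeFactorisation; factors; factorise; factorisationUnique; primeFactorisation[1])
open import Data.List using (_∷_; _++_; length; tabulate; allFin)
open import Data.List.Membership.Propositional.Properties using (∈-tabulate⁺; ∈-allFin)
open import Data.List.Properties using (length-++)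
import Data.List.Relation.Unary.All as All
open All using (_∷_)
import Data.List.Relation.Unary.All.Properties as All
open import Data.List.Relation.Binary.Permutation.Propositional.Properties using (↭-length)
open import Data.Fin as Fin using (Fin)
import Data.Fin.Properties as Fin
open import Data.Fin.Properties using (pigeonhole; toℕ-fromℕ<; finToFun-funToFin)
open import Data.Integer as ℤ using (ℤ; +_; -_; -[1+_]; _*_; ∣_∣) renaming (_+_ to _+ℤ_)
import Data.Integer.Properties as ℤ
open import Data.List.Extrema ≤-totalOrder using (argmax; f[xs]≤f[argmax])
open import Data.List.Extrema ℤ.≤-totalOrder using (min; min≤xs)
open import Data.Product using (Σ; _×_; ∃; _,_; proj₁; proj₂)
open import Data.Sum using (_⊎_; inj₁; inj₂)
open import Function.Base using (_∘_)
open import Function.Definitions using (Injective)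
open import Relation.Nullary using (yes; no; contradiction)
open import Relation.Binary.PropositionalEquality

open PrimeFactorisation using (isFactorisation; factorsPrime)

_++ᶠ_ : ∀ {m n} → PrimeFactorisation m → PrimeFactorisation n → PrimeFactorisation (m ℕ.* n)
F ++ᶠ G = record
  { factors = factors F ++ factors G
  ; isFactorisation = trans (cong₂ ℕ._*_ (isFactorisation F) (isFactorisation G))
                            (sym (product-++ (factors F) (factors G)))
  ; factorsPrime = All.++⁺ (factorsPrime F) (factorsPrime G)
  }

half-≤ : ∀ {m n} → 1 ≤ n → 2 ℕ.* n ≤ suc m → n ≤ m
half-≤ {m} {n} 1≤n 2n≤1+m = ≤-pred (begin
  suc n          ≡⟨ +-comm 1 n ⟩
  n + 1          ≤⟨ +-monoʳ-≤ n 1≤n ⟩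
  n + n          ≡⟨ cong (λ x → n + x) (sym (+-identityʳ n)) ⟩
  2 ℕ.* n        ≤⟨ 2n≤1+m ⟩
  suc m          ∎)
  where open ≤-Reasoning

-- Ωgo f n e tries the divisor 2 + e; fuel f with 2 n ≤ f + e suffices, since each step
-- either spends one unit of fuel on raising e or at least halves n.
Ωgo-factorisation : ∀ f n e → 1 ≤ n → (2 + e) Rough n → 2 ℕ.* n ≤ f + e →
                    Σ (PrimeFactorisation n) λ F → length (factors F) ≡ Ωgo f n e
Ωgo-factorisation zero    1 e _ _ _ = primeFactorisation[1] , refl
Ωgo-factorisation (suc f) 1 e _ _ _ = primeFactorisation[1] , refl
Ωgo-factorisation zero n@(suc (suc _)) e _ rough fuel = contradiction fuel (<⇒≱ e<2n)
  where
  e<2n : e < 2 ℕ.* n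
  e<2n = ≤-trans (≤-trans (n≤1+n (suc e)) (rough⇒≤ rough)) (m≤m+n n _)
Ωgo-factorisation (suc f) n@(suc (suc _)) e _ rough fuel with (2 + e) ∣? n
... | no d∤n = Ωgo-factorisation f n (suc e) (s≤s z≤n) (∤⇒rough-suc d∤n rough)
                 (≤-trans fuel (≤-reflexive (sym (+-suc f e))))
... | yes d∣n =
  record { factors = d ∷ factors F
         ; isFactorisation = trans (sym (m*[n/m]≡n d∣n)) (cong (d ℕ.*_) (isFactorisation F))
         ; factorsPrime = rough∧∣⇒prime rough d∣n ∷ factorsPrime F }
  , cong suc |F|
  where
  d : ℕ
  d = 2 + e
  2q≤n : 2 ℕ.* (n / d) ≤ n
  2q≤n = ≤-trans (*-monoˡ-≤ (n / d) {2} {d} (s≤s (s≤s z≤n))) (≤-reflexive (m*[n/m]≡n d∣n))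
  recursive : Σ (PrimeFactorisation (n / d)) λ F → length (factors F) ≡ Ωgo f (n / d) e
  recursive = Ωgo-factorisation f (n / d) e (m≥n⇒m/n>0 (∣⇒≤ d∣n))
                (rough∧∣⇒rough rough (m/n∣m d∣n)) (≤-trans 2q≤n (half-≤ (s≤s z≤n) fuel))
  F : PrimeFactorisation (n / d)
  F = proj₁ recursive
  |F| : length (factors F) ≡ Ωgo f (n / d) e
  |F| = proj₂ recursive

Ω≡length-factors : ∀ {n} → .{{NonZero n}} → (F : PrimeFactorisation n) → Ω n ≡ length (factors F)
Ω≡length-factors {n} F =
  let (F₀ , |F₀|) = Ωgo-factorisation (2 ℕ.* n) n 0 (ℕ.>-nonZero⁻¹ n) 2-rough (≤-reflexive (sym (+-identityʳ _)))
  in trans (sym |F₀|) (↭-length (factorisationUnique F₀ F))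

Ω-* : ∀ m n → .{{NonZero m}} → .{{NonZero n}} → Ω (m ℕ.* n) ≡ Ω m + Ω n
Ω-* m n = begin
  Ω (m ℕ.* n)                             ≡⟨ Ω≡length-factors {{m*n≢0 m n}} (F ++ᶠ G) ⟩
  length (factors F ++ factors G)         ≡⟨ length-++ (factors F) ⟩
  length (factors F) + length (factors G) ≡⟨ cong₂ _+_ (Ω≡length-factors F) (Ω≡length-factors G) ⟨
  Ω m + Ω n                               ∎
  where
  open ≡-Reasoning
  F = factorise m
  G = factorise n

neg1^-+ : ∀ m n → neg1^ (m + n) ≡ neg1^ m * neg1^ n
neg1^-+ zero    n = sym (ℤ.*-identityˡ (neg1^ n))
neg1^-+ (suc m) n = trans (cong -_ (neg1^-+ m n)) (ℤ.neg-distribˡ-* (neg1^ m) (neg1^ n))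

liouville≡neg1^Ω : ∀ z → liouville z ≡ neg1^ (Ω ∣ z ∣)
liouville≡neg1^Ω z with ∣ z ∣
... | zero  = refl
... | suc _ = refl

liouville-* : ∀ z w → .{{ℤ.NonZero z}} → .{{ℤ.NonZero w}} →
              liouville (z * w) ≡ liouville z * liouville w
liouville-* z w = begin
  liouville (z * w)                   ≡⟨ liouville≡neg1^Ω (z * w) ⟩
  neg1^ (Ω ∣ z * w ∣)                 ≡⟨ cong (neg1^ ∘ Ω) (ℤ.abs-* z w) ⟩
  neg1^ (Ω (∣ z ∣ ℕ.* ∣ w ∣))         ≡⟨ cong neg1^ (Ω-* ∣ z ∣ ∣ w ∣) ⟩
  neg1^ (Ω (∣ z ∣) + Ω (∣ w ∣))       ≡⟨ neg1^-+ (Ω ∣ z ∣) (Ω ∣ w ∣) ⟩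
  neg1^ (Ω ∣ z ∣) * neg1^ (Ω ∣ w ∣)   ≡⟨ cong₂ _*_ (liouville≡neg1^Ω z) (liouville≡neg1^Ω w) ⟨
  liouville z * liouville w           ∎
  where open ≡-Reasoning

IsUnit : ℤ → Set
IsUnit z = z ≡ + 1 ⊎ z ≡ - + 1

neg1^-isUnit : ∀ n → IsUnit (neg1^ n)
neg1^-isUnit zero = inj₁ refl
neg1^-isUnit (suc n) with neg1^-isUnit n
... | inj₁ eq = inj₂ (cong -_ eq)
... | inj₂ eq = inj₁ (cong -_ eq)

liouville-isUnit : ∀ z → IsUnit (liouville z)
liouville-isUnit z = subst IsUnit (sym (liouville≡neg1^Ω z)) (neg1^-isUnit (Ω ∣ z ∣))

isUnit⇒nonZero : ∀ {z} → IsUnit z → ℤ.NonZero z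
isUnit⇒nonZero (inj₁ refl) = _
isUnit⇒nonZero (inj₂ refl) = _

unitCode : ℤ → Fin 2
unitCode (+ 1) = Fin.zero
unitCode _     = Fin.suc Fin.zero

unitCode-injective : ∀ {x y} → IsUnit x → IsUnit y → unitCode x ≡ unitCode y → x ≡ y
unitCode-injective (inj₁ refl) (inj₁ refl) _  = refl
unitCode-injective (inj₁ refl) (inj₂ refl) ()
unitCode-injective (inj₂ refl) (inj₁ refl) ()
unitCode-injective (inj₂ refl) (inj₂ refl) _  = refl

prodFin-cong : ∀ k {x y : Fin k → ℤ} → (∀ j → x j ≡ y j) → prodFin k x ≡ prodFin k y
prodFin-cong zero    x≡y = refl
prodFin-cong (suc k) x≡y = cong₂ _*_ (x≡y Fin.zero) (prodFin-cong k (x≡y ∘ Fin.suc))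

prodFin-nonZero : ∀ k (x : Fin k → ℤ) → (∀ j → ℤ.NonZero (x j)) → ℤ.NonZero (prodFin k x)
prodFin-nonZero zero    x nz = _
prodFin-nonZero (suc k) x nz =
  ℤ.i*j≢0 (x Fin.zero) _ {{nz Fin.zero}} {{prodFin-nonZero k (x ∘ Fin.suc) (nz ∘ Fin.suc)}}

liouville-prodFin : ∀ k (x : Fin k → ℤ) → (∀ j → ℤ.NonZero (x j)) →
                    liouville (prodFin k x) ≡ prodFin k (liouville ∘ x)
liouville-prodFin zero    x nz = refl
liouville-prodFin (suc k) x nz = trans
  (liouville-* (x Fin.zero) _ {{nz Fin.zero}} {{prodFin-nonZero k (x ∘ Fin.suc) (nz ∘ Fin.suc)}})
  (cong (liouville (x Fin.zero) *_) (liouville-prodFin k (x ∘ Fin.suc) (nz ∘ Fin.suc)))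

prodFin-cancel : ∀ k (x y : Fin k → ℤ) (j₀ : Fin k) → (∀ j → ℤ.NonZero (x j)) →
                 (∀ j → j ≢ j₀ → x j ≡ y j) → prodFin k x ≡ prodFin k y → x j₀ ≡ y j₀
prodFin-cancel (suc k) x y Fin.zero nz x≡y Πx≡Πy =
  ℤ.*-cancelʳ-≡ _ _ _ {{prodFin-nonZero k (x ∘ Fin.suc) (nz ∘ Fin.suc)}}
    (trans Πx≡Πy (cong (y Fin.zero *_) (prodFin-cong k (λ j → sym (x≡y (Fin.suc j) λ ())))))
prodFin-cancel (suc k) x y (Fin.suc j₀) nz x≡y Πx≡Πy =
  prodFin-cancel k (x ∘ Fin.suc) (y ∘ Fin.suc) j₀ (nz ∘ Fin.suc)
    (λ j j≢j₀ → x≡y (Fin.suc j) (j≢j₀ ∘ Fin.suc-injective))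
    (ℤ.*-cancelˡ-≡ (x Fin.zero) _ _ {{nz Fin.zero}}
      (trans Πx≡Πy (cong (_* prodFin k (y ∘ Fin.suc)) (sym (x≡y Fin.zero λ ())))))

module _ {A : Set} (f : ℕ → A) where

  EventuallyPeriodic : Set
  EventuallyPeriodic = Σ ℕ λ N → Σ ℕ λ p → 1 ≤ p × (∀ n → N ≤ n → f (n + p) ≡ f n)

  AgreeBelow : ℕ → ℕ → ℕ → Set
  AgreeBelow s a b = ∀ i → i < s → f (a + i) ≡ f (b + i)

  Recurrent : ℕ → ℕ → Set
  Recurrent M s = ∀ a b → M ≤ a → M ≤ b → AgreeBelow s a b → f (a + s) ≡ f (b + s)

  recurrent⇒agree : ∀ {M s a b} → Recurrent M s → M ≤ a → M ≤ b → AgreeBelow s a b →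
                    ∀ t → f (a + t) ≡ f (b + t)
  recurrent⇒agree {M} {s} {a} {b} rec M≤a M≤b agree = <-rec _ step
    where
    step : ∀ t → (∀ {u} → u < t → f (a + u) ≡ f (b + u)) → f (a + t) ≡ f (b + t)
    step t ih with s ℕ.≤? t
    ... | no s≰t = agree t (≰⇒> s≰t)
    ... | yes s≤t with u , refl ← m≤n⇒∃[o]m+o≡n s≤t =
      subst₂ (λ x y → f x ≡ f y) (sym (x∙yz≈xz∙y a s u)) (sym (x∙yz≈xz∙y b s u))
        (rec (a + u) (b + u) (≤-trans M≤a (m≤m+n a u)) (≤-trans M≤b (m≤m+n b u))
          λ i i<s → subst₂ (λ x y → f x ≡ f y) (sym (+-assoc a u i)) (sym (+-assoc b u i))
                      (ih (≤-trans (+-monoʳ-< u i<s) (≤-reflexive (+-comm u s)))))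

  window : ∀ {q} → (A → Fin q) → (s a : ℕ) → Fin s → Fin q
  window code s a i = code (f (a + Fin.toℕ i))

  window-agree : ∀ {q} (code : A → Fin q) → (∀ m n → code (f m) ≡ code (f n) → f m ≡ f n) →
                 ∀ {s a b} → Fin.funToFin (window code s a) ≡ Fin.funToFin (window code s b) →
                 AgreeBelow s a b
  window-agree code code-injective {s} {a} {b} same i i<s =
    subst₂ (λ x y → f (a + x) ≡ f (b + y)) (toℕ-fromℕ< i<s) (toℕ-fromℕ< i<s)
      (code-injective _ _ (begin
        window code s a k                               ≡⟨ finToFun-funToFin (window code s a) k ⟨
        Fin.finToFun (Fin.funToFin (window code s a)) k ≡⟨ cong (λ c → Fin.finToFun c k) same ⟩
        Fin.finToFun (Fin.funToFin (window code s b)) k ≡⟨ finToFun-funToFin (window code s b) k ⟩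
        window code s b k                               ∎))
    where
    open ≡-Reasoning
    k : Fin s
    k = Fin.fromℕ< i<s

  agree⇒periodic : ∀ {a b p} → a + p ≡ b → (∀ t → f (a + t) ≡ f (b + t)) →
                   ∀ n → a ≤ n → f (n + p) ≡ f n
  agree⇒periodic {a} {p = p} refl agree n a≤n with t , refl ← m≤n⇒∃[o]m+o≡n a≤n =
    trans (cong f (xy∙z≈xz∙y a t p)) (sym (agree t))

  -- Among the q ^ s + 1 windows starting at M, …, M + q ^ s, two have the same code.
  recurrent⇒eventuallyPeriodic : ∀ {q} (code : A → Fin q) →
                                 (∀ m n → code (f m) ≡ code (f n) → f m ≡ f n) →
                                 ∀ {M s} → Recurrent M s → EventuallyPeriodic
  recurrent⇒eventuallyPeriodic {q} code code-injective {M} {s} rec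
    with i , j , i<j , same ← pigeonhole (n<1+n (q ^ s))
                                (λ i → Fin.funToFin (window code s (M + Fin.toℕ i)))
    with o , i+1+o≡j ← m≤n⇒∃[o]m+o≡n i<j =
    M + Fin.toℕ i , suc o , s≤s z≤n ,
    agree⇒periodic (trans (+-assoc M _ (suc o)) (cong (λ x → M + x) (trans (+-suc _ o) i+1+o≡j)))
      (recurrent⇒agree rec (m≤m+n M _) (m≤m+n M _) (window-agree code code-injective same))

constantProduct⇒recurrent : ∀ {k M v} (f : ℕ → ℤ) → (∀ m → ℤ.NonZero (f m)) →
                            (o : Fin k → ℕ) → Injective _≡_ _≡_ o →
                            (j₀ : Fin k) → (∀ j → o j ≤ o j₀) →
                            (∀ m → M ≤ m → prodFin k (λ j → f (m + o j)) ≡ v) →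
                            Recurrent f M (o j₀)
constantProduct⇒recurrent f nz o o-injective j₀ o≤o[j₀] constant a b M≤a M≤b agree =
  prodFin-cancel _ (λ j → f (a + o j)) (λ j → f (b + o j)) j₀ (λ j → nz (a + o j))
    (λ j j≢j₀ → agree (o j) (≤∧≢⇒< (o≤o[j₀] j) (j≢j₀ ∘ o-injective)))
    (trans (constant a M≤a) (sym (constant b M≤b)))

argmax-Fin : ∀ {k} (o : Fin (suc k) → ℕ) → Σ (Fin (suc k)) λ j₀ → ∀ j → o j ≤ o j₀
argmax-Fin {k} o = j₀ , λ j → All.lookup (f[xs]≤f[argmax] {f = o} Fin.zero (allFin (suc k))) (∈-allFin j)
  where
  j₀ : Fin (suc k)
  j₀ = argmax o Fin.zero (allFin (suc k))

c≤x⇒x≡c+∣x-c∣ : ∀ {c x} → c ℤ.≤ x → x ≡ c +ℤ + ∣ x ℤ.- c ∣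
c≤x⇒x≡c+∣x-c∣ {c} {x} c≤x = sym (begin
  c +ℤ + ∣ x ℤ.- c ∣ ≡⟨ cong (c +ℤ_) (ℤ.0≤i⇒+∣i∣≡i (ℤ.i≤j⇒0≤j-i c≤x)) ⟩
  c +ℤ (x ℤ.- c)     ≡⟨ cong (c +ℤ_) (ℤ.+-comm x (- c)) ⟩
  c +ℤ (- c +ℤ x)    ≡⟨ ℤ.+-assoc c (- c) x ⟨
  (c ℤ.- c) +ℤ x     ≡⟨ cong (_+ℤ x) (ℤ.+-inverseʳ c) ⟩
  + 0 +ℤ x           ≡⟨ ℤ.+-identityˡ x ⟩
  x                  ∎)
  where open ≡-Reasoning

nonnegativeOffsets : ∀ {k} (h : Fin k → ℤ) → Σ ℤ λ c → Σ (Fin k → ℕ) λ o → ∀ j → h j ≡ c +ℤ + o j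
nonnegativeOffsets {k} h = c , (λ j → ∣ h j ℤ.- c ∣) , λ j → c≤x⇒x≡c+∣x-c∣ (c≤h j)
  where
  c : ℤ
  c = min (+ 0) (tabulate h)
  c≤h : ∀ j → c ℤ.≤ h j
  c≤h j = All.lookup (min≤xs (+ 0) (tabulate h)) (∈-tabulate⁺ j)

index-shift : ∀ N c m → N + ∣ c ∣ ≤ m → ∃ λ n → N ≤ n × + n +ℤ c ≡ + m
index-shift N (+ a) m N+a≤m with r , refl ← m≤n⇒∃[o]m+o≡n N+a≤m =
  N + r , m≤m+n N r , cong +_ (xy∙z≈xz∙y N r a)
index-shift N -[1+ a ] m N+1+a≤m =
  m + suc a , ≤-trans (≤-trans (m≤m+n N (suc a)) N+1+a≤m) (m≤m+n m (suc a)) ,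
  trans (ℤ.≤-⊖ (m≤n+m (suc a) m)) (cong +_ (m+n∸n≡m m (suc a)))

+n+i≢0 : ∀ n i → ∣ i ∣ < n → ℤ.NonZero (+ n +ℤ i)
+n+i≢0 (suc n) (+ a)     _     = _
+n+i≢0 n       -[1+ a ] 1+a<n rewrite ℤ.⊖-≥ (<⇒≤ 1+a<n) = ℕ.>-nonZero (m<n⇒0<n∸m 1+a<n)

square+i≢0 : ∀ u i → ∣ i ∣ < u → ℤ.NonZero (+ u * + u +ℤ i)
square+i≢0 u i ∣i∣<u = subst (λ x → ℤ.NonZero (x +ℤ i)) (ℤ.pos-* u u)
  (+n+i≢0 (u ℕ.* u) i (<-≤-trans ∣i∣<u (m≤m*n u u {{ℕ.>-nonZero (≤-<-trans z≤n ∣i∣<u)}})))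

constantProduct-atOffsets :
  ∀ D {k} (h : Fin k → ℤ) c (o : Fin k → ℕ) → (∀ j → h j ≡ c +ℤ + o j) → ∀ {N v} →
  (∀ n → N ≤ n → liouville (prodFin k (λ j → (+ n +ℤ h j) * (+ n +ℤ h j) +ℤ D)) ≡ v) →
  ∀ m → (N + ∣ c ∣) ⊔ suc ∣ D ∣ ≤ m →
  prodFin k (λ j → liouville (+ (m + o j) * + (m + o j) +ℤ D)) ≡ v
constantProduct-atOffsets D {k} h c o h≡c+o {N} {v} constant m M≤m = begin
  prodFin k (λ j → liouville (Q (m + o j)))    ≡⟨ liouville-prodFin k (λ j → Q (m + o j)) Q[m+o]≢0 ⟨
  liouville (prodFin k (λ j → Q (m + o j)))    ≡⟨ cong liouville (prodFin-cong k (cong R ∘ n+h≡m+o)) ⟨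
  liouville (prodFin k (λ j → R (+ n +ℤ h j))) ≡⟨ constant n N≤n ⟩
  v                                            ∎
  where
  open ≡-Reasoning
  R : ℤ → ℤ
  R x = x * x +ℤ D
  Q : ℕ → ℤ
  Q u = R (+ u)
  shift : ∃ λ n → N ≤ n × + n +ℤ c ≡ + m
  shift = index-shift N c m (≤-trans (m≤m⊔n _ _) M≤m)
  n : ℕ
  n = proj₁ shift
  N≤n : N ≤ n
  N≤n = proj₁ (proj₂ shift)
  n+h≡m+o : ∀ j → + n +ℤ h j ≡ + (m + o j)
  n+h≡m+o j = begin
    + n +ℤ h j            ≡⟨ cong (+ n +ℤ_) (h≡c+o j) ⟩
    + n +ℤ (c +ℤ + o j)   ≡⟨ ℤ.+-assoc (+ n) c (+ o j) ⟨
    (+ n +ℤ c) +ℤ + o j   ≡⟨ cong (_+ℤ + o j) (proj₂ (proj₂ shift)) ⟩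
    + (m + o j)           ∎
  Q[m+o]≢0 : ∀ j → ℤ.NonZero (Q (m + o j))
  Q[m+o]≢0 j = square+i≢0 (m + o j) D (≤-trans (≤-trans (m≤n⊔m _ _) M≤m) (m≤m+n m (o j)))

lemma7p1 : (D : ℤ) (k : ℕ) → 1 ≤ k → (h : Fin k → ℤ) → Injective _≡_ _≡_ h →
    (v : ℤ) → (v ≡ + 1 ⊎ v ≡ - (+ 1)) →
    (Σ ℕ λ N → ∀ n → N ≤ n →
    liouville (prodFin k (λ j → ((+ n +ℤ h j) * (+ n +ℤ h j)) +ℤ D)) ≡ v) →
    Σ ℕ λ N → Σ ℕ λ p → 1 ≤ p × (∀ n → N ≤ n →
    liouville ((+ (n + p)) * (+ (n + p)) +ℤ D) ≡ liouville ((+ n) * (+ n) +ℤ D))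
-- Only the constancy of the product is used, not the value v.
lemma7p1 _ zero () _ _ _ _ _
lemma7p1 D (suc k) _ h h-injective _ _ (N , constant) =
  recurrent⇒eventuallyPeriodic f unitCode
    (λ m n → unitCode-injective (f-isUnit m) (f-isUnit n))
    (constantProduct⇒recurrent f (isUnit⇒nonZero ∘ f-isUnit) o o-injective j₀ o≤o[j₀]
      (constantProduct-atOffsets D h c o h≡c+o constant))
  where
  f : ℕ → ℤ
  f m = liouville (+ m * + m +ℤ D)
  f-isUnit : ∀ m → IsUnit (f m)
  f-isUnit m = liouville-isUnit (+ m * + m +ℤ D)
  offsets : Σ ℤ λ c → Σ (Fin (suc k) → ℕ) λ o → ∀ j → h j ≡ c +ℤ + o j
  offsets = nonnegativeOffsets h
  c : ℤ
  c = proj₁ offsets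
  o : Fin (suc k) → ℕ
  o = proj₁ (proj₂ offsets)
  h≡c+o : ∀ j → h j ≡ c +ℤ + o j
  h≡c+o = proj₂ (proj₂ offsets)
  o-injective : Injective _≡_ _≡_ o
  o-injective {i} {j} oi≡oj =
    h-injective (trans (h≡c+o i) (trans (cong (λ x → c +ℤ + x) oi≡oj) (sym (h≡c+o j))))
  j₀ : Fin (suc k)
  j₀ = proj₁ (argmax-Fin o)
  o≤o[j₀] : ∀ j → o j ≤ o j₀
  o≤o[j₀] = proj₂ (argmax-Fin o)
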